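{- Let $G$ be a finite chordal graph that is not a clique. Then $G$ contains two non-adjacent special simplicial vertices.
   Context: Graphs are finite, without loops or parallel edges. A graph is chordal if it has no induced cycle of length at least four. For vertices $u,v$ of $G$, a $\{u,v\}$-separator is a set $S$ of vertices such that $u$ and $v$ lie in different connected components of $G\setminus S$, and $S$ is inclusion-minimal with this property. A set is a separator if it is a $\{u,v\}$-separator for some vertices $u,v$ of $G$; $\mathcal S(G)$ denotes the set of all separators of $G$. $N(v)$ denotes the set of vertices adjacent to $v$. A vertex $v$ is simplicial if $N(v)$ is a clique. For a simplicial vertex $v$, let $Q_v=N(v)\cup\{v\}$ and $S_v=Q_v\cap N(V(G)\setminus Q_v)$, i.e. the set of vertices of $Q_v$ that have a neighbor outside $Q_v$. A simplicial vertex $v$ is special if $S_v\in\mathcal S(G)$ and $S_v$ is an inclusion-maximal element of $\mathcal S(G)$. -}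

module Defs where

open import Level using (0ℓ)
open import Data.Nat using (ℕ; suc; _+_)
open import Data.Nat.DivMod using (_%_)
open import Data.Fin using (Fin; toℕ)
open import Data.Product using (Σ; ∃; _×_; _,_)
open import Data.Sum using (_⊎_)
open import Function.Definitions using (Injective)
open import Function.Bundles using (_⇔_)
open import Relation.Nullary using (¬_; Dec)
open import Relation.Unary using (Pred; _∈_; _∉_; _⊆_)
open import Relation.Binary.PropositionalEquality using (_≡_; _≢_)

record Graph (n : ℕ) : Set₁ where
  field
    Adj   : Fin n → Fin n → Set
    adj?  : ∀ u v → Dec (Adj u v)
    sym   : ∀ {u v} → Adj u v → Adj v u
    irrefl : ∀ {u} → ¬ Adj u u

open Graph public

VSet : ℕ → Set₁
VSet n = Pred (Fin n) 0ℓ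

module _ {n : ℕ} (G : Graph n) where

  data Reach (S : VSet n) (u : Fin n) : Fin n → Set where
    here : u ∉ S → Reach S u u
    step : ∀ {w v} → Reach S u w → Adj G w v → v ∉ S → Reach S u v

  Separates : VSet n → Fin n → Fin n → Set
  Separates S u v = u ∉ S × v ∉ S × ¬ Reach S u v

  _⊂_ : VSet n → VSet n → Set
  T ⊂ S = T ⊆ S × ¬ (S ⊆ T)

  IsUVSeparator : VSet n → Fin n → Fin n → Set₁
  IsUVSeparator S u v = Separates S u v × (∀ (T : VSet n) → T ⊂ S → ¬ Separates T u v)

  IsSeparator : VSet n → Set₁
  IsSeparator S = ∃ λ u → ∃ λ v → IsUVSeparator S u v

  IsMaximalSeparator : VSet n → Set₁
  IsMaximalSeparator S = IsSeparator S × (∀ (T : VSet n) → IsSeparator T → S ⊆ T → T ⊆ S)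

  IsClique : VSet n → Set
  IsClique K = ∀ {x y} → x ∈ K → y ∈ K → x ≢ y → Adj G x y

  IsCompleteGraph : Set
  IsCompleteGraph = ∀ (x y : Fin n) → x ≢ y → Adj G x y

  N : Fin n → VSet n
  N v x = Adj G v x

  IsSimplicial : Fin n → Set
  IsSimplicial v = IsClique (N v)

  Q : Fin n → VSet n
  Q v x = x ≡ v ⊎ Adj G v x

  SV : Fin n → VSet n
  SV v x = x ∈ Q v × ∃ λ y → y ∉ Q v × Adj G x y

  IsSpecial : Fin n → Set₁
  IsSpecial v = IsSimplicial v × IsMaximalSeparator (SV v)

  CycAdj : (m : ℕ) → Fin (4 + m) → Fin (4 + m) → Set
  CycAdj m i j = (suc (toℕ i)) % (4 + m) ≡ toℕ j ⊎ (suc (toℕ j)) % (4 + m) ≡ toℕ i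

  IsInducedCycle : (m : ℕ) → (Fin (4 + m) → Fin n) → Set
  IsInducedCycle m f = Injective _≡_ _≡_ f × (∀ i j → Adj G (f i) (f j) ⇔ CycAdj m i j)

  Chordal : Set
  Chordal = ∀ (m : ℕ) (f : Fin (4 + m) → Fin n) → ¬ IsInducedCycle m f

module Submission where

-- Every minimal separator of a chordal graph is a clique (Dirac): shortest paths between two of
-- its vertices through two full components of G ∖ S would close up into an induced cycle of
-- length at least four. Let S be a maximal separator with full components C and C′. We find a
-- special vertex in C by induction on |C|. If S ∪ C is a clique, every vertex of C is simplicial
-- with S as its S_v. Otherwise a non-adjacent pair in S ∪ C has a minimal separator meeting C;
-- enlarged to a maximal separator T it has a full component inside C avoiding the clique S (T
-- cannot contain S by maximality), and that component is smaller than C since it misses T ∩ C.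
-- The special vertices found in C and C′ lie in different components, so they are non-adjacent.

open import Defs renaming (sym to Adj-sym)
open import Data.Nat as ℕ using (ℕ; zero; suc; _+_; _∸_; _≤_; _<_; z≤n; s≤s; s≤s⁻¹; _%_)
open import Data.Nat.DivMod using (m<n⇒m%n≡m; n%n≡0)
open import Data.Nat.Properties
open import Data.Nat.Induction using (<-rec)
open import Relation.Binary.Definitions using (tri<; tri≈; tri>)
open import Data.Fin as F using (Fin; toℕ)
open import Data.Fin.Properties using (any?; all?; toℕ<n; toℕ-injective) renaming (_≟_ to _≟F_)
open import Data.Fin.Subset as Sub using (Subset)
open import Data.Fin.Subset.Properties using (anySubset?) renaming (_∈?_ to _∈ₛ?_)
open import Data.Fin.Subset.Induction using (⊂-wellFounded; ⊃-wellFounded)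
open import Induction.WellFounded using (Acc; acc)
open import Data.Vec using (tabulate)
open import Data.Vec.Properties using (lookup∘tabulate; []=⇒lookup; lookup⇒[]=)
open import Data.Bool.Properties using (T-≡)
open import Data.Product
open import Data.Sum
open import Data.Empty
open import Function using (_∘_; id)
open import Function.Bundles using (mk⇔; Equivalence)
open import Relation.Nullary
open import Relation.Nullary.Decidable
  using (_×-dec_; _→-dec_; ¬?; decidable-stable; ¬¬-excluded-middle; isYes; toWitness; fromWitness)
open import Relation.Unary using (Decidable; _∉_; _⊆_; _≐_; ｛_｝; _∪_; _∖_)
open import Relation.Unary.Properties using (_∪?_; _∩?_; ∁?)
open import Relation.Binary.PropositionalEquality hiding ([_])

¬¬-∀-Fin : ∀ {m} {P : Fin m → Set} → (∀ x → ¬ ¬ P x) → ¬ ¬ (∀ x → P x)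
¬¬-∀-Fin {zero}      h k = k (λ ())
¬¬-∀-Fin {suc m} {P} h k =
  h F.zero λ p₀ → ¬¬-∀-Fin {P = P ∘ F.suc} (h ∘ F.suc) λ pₛ →
  k λ { F.zero → p₀ ; (F.suc x) → pₛ x }

¬¬-decidable : ∀ {n} (P : VSet n) → ¬ ¬ Decidable P
¬¬-decidable P = ¬¬-∀-Fin (λ x → ¬¬-excluded-middle)

module _ {n : ℕ} where

  toSubset : {P : VSet n} → Decidable P → Subset n
  toSubset P? = tabulate (isYes ∘ P?)

  ∈-toSubset⁺ : ∀ {P : VSet n} (P? : Decidable P) {x} → P x → x Sub.∈ toSubset P?
  ∈-toSubset⁺ P? {x} px =
    lookup⇒[]= x _ (trans (lookup∘tabulate _ x) (Equivalence.to T-≡ (fromWitness px)))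

  ∈-toSubset⁻ : ∀ {P : VSet n} (P? : Decidable P) {x} → x Sub.∈ toSubset P? → P x
  ∈-toSubset⁻ P? {x} h =
    toWitness {a? = P? x} (Equivalence.from T-≡ (trans (sym (lookup∘tabulate _ x)) ([]=⇒lookup h)))

  toSubset-⊂ : ∀ {P Q : VSet n} (P? : Decidable P) (Q? : Decidable Q) {y} →
               P ⊆ Q → Q y → ¬ P y → toSubset P? Sub.⊂ toSubset Q?
  toSubset-⊂ P? Q? {y} P⊆Q qy ¬py =
    (∈-toSubset⁺ Q? ∘ P⊆Q ∘ ∈-toSubset⁻ P?) , y , ∈-toSubset⁺ Q? qy , (¬py ∘ ∈-toSubset⁻ P?)

  toSubset-≐ : ∀ {P : VSet n} (P? : Decidable P) → P ≐ (Sub._∈ toSubset P?)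
  toSubset-≐ P? = ∈-toSubset⁺ P? , ∈-toSubset⁻ P?

module _ {n : ℕ} (G : Graph n) where

  -- Reachability in G ∖ S

  reach-∉ˡ : ∀ {S u v} → Reach G S u v → u ∉ S
  reach-∉ˡ (here u∉S)  = u∉S
  reach-∉ˡ (step r _ _) = reach-∉ˡ r

  reach-∉ʳ : ∀ {S u v} → Reach G S u v → v ∉ S
  reach-∉ʳ (here v∉S)     = v∉S
  reach-∉ʳ (step _ _ v∉S) = v∉S

  reach-trans : ∀ {S u w v} → Reach G S u w → Reach G S w v → Reach G S u v
  reach-trans r (here _)          = r
  reach-trans r (step r′ a v∉S) = step (reach-trans r r′) a v∉S

  reach-prepend : ∀ {S u w v} → u ∉ S → Adj G u w → Reach G S w v → Reach G S u v
  reach-prepend u∉S a r = reach-trans (step (here u∉S) a (reach-∉ˡ r)) r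

  reach-sym : ∀ {S u v} → Reach G S u v → Reach G S v u
  reach-sym (here v∉S)     = here v∉S
  reach-sym (step r a v∉S) = reach-prepend v∉S (Adj-sym G a) (reach-sym r)

  reach-restrict : ∀ {S T u v} → Reach G S u v → (∀ {z} → Reach G S u z → z ∉ T) → Reach G T u v
  reach-restrict (here u∉S)     avoid = here (avoid (here u∉S))
  reach-restrict (step r a v∉S) avoid = step (reach-restrict r avoid) a (avoid (step r a v∉S))

  reach-mono : ∀ {S T u v} → T ⊆ S → Reach G S u v → Reach G T u v
  reach-mono T⊆S r = reach-restrict r (λ r′ → reach-∉ʳ r′ ∘ T⊆S)

  reach-first-step : ∀ {S u v} → Reach G S u v →
                     u ≡ v ⊎ ∃ λ w → Adj G u w × Reach G (S ∪ ｛ u ｝) w v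
  reach-first-step (here _) = inj₁ refl
  reach-first-step {u = u} (step {v = v} r a v∉S) with u ≟F v | reach-first-step r
  ... | yes u≡v | _                  = inj₁ u≡v
  ... | no u≢v  | inj₁ refl          = inj₂ (v , a , here [ v∉S , u≢v ])
  ... | no u≢v  | inj₂ (w′ , a′ , r′) = inj₂ (w′ , a′ , step r′ a [ v∉S , u≢v ])

  reach?-acc : ∀ {S} (S? : Decidable S) → Acc Sub._⊃_ (toSubset S?) → ∀ u v → Dec (Reach G S u v)
  reach?-acc S? (acc rec) u v with S? u | u ≟F v
  ... | yes u∈S | _        = no (λ r → reach-∉ˡ r u∈S)
  ... | no u∉S  | yes refl = yes (here u∉S)
  ... | no u∉S  | no u≢v
    with any? (λ w → adj? G u w ×-dec reach?-acc S∪u? (rec S⊂S∪u) w v)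
    where
    S∪u? = S? ∪? (u ≟F_)
    S⊂S∪u = toSubset-⊂ S? S∪u? inj₁ (inj₂ refl) u∉S
  ...   | yes (w , a , r) = yes (reach-prepend u∉S a (reach-mono inj₁ r))
  ...   | no ¬w           = no (λ r → [ u≢v , ¬w ] (reach-first-step r))

  reach? : ∀ {S} → Decidable S → ∀ u v → Dec (Reach G S u v)
  reach? S? = reach?-acc S? (⊃-wellFounded _)

  reach-apart : ∀ {S a b x y} → ¬ Reach G S a b → Reach G S a x → Reach G S b y →
                ¬ Adj G x y × x ≢ y
  reach-apart ¬ab ax by =
    (λ xy → ¬ab (reach-trans (step ax xy (reach-∉ʳ by)) (reach-sym by))) ,
    (λ { refl → ¬ab (reach-trans ax (reach-sym by)) })

  -- Separators

  separates-sym : ∀ {S a b} → Separates G S a b → Separates G S b a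
  separates-sym (a∉S , b∉S , ¬ab) = b∉S , a∉S , ¬ab ∘ reach-sym

  separates-mono : ∀ {S T a b} → S ⊆ T → a ∉ T → b ∉ T → Separates G S a b → Separates G T a b
  separates-mono S⊆T a∉T b∉T (_ , _ , ¬ab) = a∉T , b∉T , ¬ab ∘ reach-mono S⊆T

  separates? : ∀ {S} → Decidable S → ∀ a b → Dec (Separates G S a b)
  separates? S? a b = ¬? (S? a) ×-dec ¬? (S? b) ×-dec ¬? (reach? S? a b)

  uv-separator-sym : ∀ {S a b} → IsUVSeparator G S a b → IsUVSeparator G S b a
  uv-separator-sym (sep , minimal) = separates-sym sep , λ T T⊂S → minimal T T⊂S ∘ separates-sym

  uv-separator-resp-≐ : ∀ {S T a b} → S ≐ T → IsUVSeparator G S a b → IsUVSeparator G T a b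
  uv-separator-resp-≐ (S⊆T , T⊆S) (sep , minimal) =
    separates-mono S⊆T (proj₁ sep ∘ T⊆S) (proj₁ (proj₂ sep) ∘ T⊆S) sep ,
    λ U (U⊆T , T⊈U) → minimal U (T⊆S ∘ U⊆T , λ S⊆U → T⊈U (S⊆U ∘ T⊆S))

  separator-resp-≐ : ∀ {S T} → S ≐ T → IsSeparator G S → IsSeparator G T
  separator-resp-≐ S≐T (a , b , uv) = a , b , uv-separator-resp-≐ S≐T uv

  maximal-separator-resp-≐ : ∀ {S T} → S ≐ T → IsMaximalSeparator G S → IsMaximalSeparator G T
  maximal-separator-resp-≐ S≐T@(S⊆T , T⊆S) (sep , maximal) =
    separator-resp-≐ S≐T sep , λ U sepU T⊆U → S⊆T ∘ maximal U sepU (T⊆U ∘ S⊆T)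

  Full : VSet n → Fin n → Set
  Full S u = ∀ {s} → S s → ∃ λ c → Reach G S u c × Adj G c s

  full-∉ : ∀ {S u} → Full S u → u ∉ S
  full-∉ full u∈S = reach-∉ˡ (proj₁ (proj₂ (full u∈S))) u∈S

  FullComponents : VSet n → Fin n → Fin n → Set
  FullComponents S u u′ = Full S u × Full S u′ × ¬ Reach G S u u′

  full-components-sym : ∀ {S u u′} → FullComponents S u u′ → FullComponents S u′ u
  full-components-sym (full , full′ , ¬uu′) = full′ , full , ¬uu′ ∘ reach-sym

  reach-without : ∀ {S s a y} → Decidable S → a ∉ S → Reach G (S ∖ ｛ s ｝) a y →
                  Reach G S a y ⊎ ∃ λ c → Reach G S a c × Adj G c s
  reach-without S? a∉S (here _) = inj₁ (here a∉S)
  reach-without {s = s} S? a∉S (step {w} {y} r a v∉S∖s) with reach-without S? a∉S r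
  ... | inj₂ c = inj₂ c
  ... | inj₁ r′ with S? y | s ≟F y
  ...   | no y∉S  | _        = inj₁ (step r′ a y∉S)
  ...   | yes _   | yes refl = inj₂ (w , r′ , a)
  ...   | yes y∈S | no s≢y   = ⊥-elim (v∉S∖s (y∈S , s≢y))

  -- If some s ∈ S had no neighbour in the component of a, then S ∖ {s} would still separate.
  uv-separator-full : ∀ {S a b} → Decidable S → IsUVSeparator G S a b → Full S a
  uv-separator-full {S} S? ((a∉S , b∉S , ¬ab) , minimal) {s} s∈S
    with any? (λ c → reach? S? _ c ×-dec adj? G c s)
  ... | yes c = c
  ... | no ¬c = ⊥-elim (minimal (S ∖ ｛ s ｝) (proj₁ , λ S⊆S∖s → proj₂ (S⊆S∖s s∈S) refl)
                          (a∉S ∘ proj₁ , b∉S ∘ proj₁ , [ ¬ab , ¬c ] ∘ reach-without S? a∉S))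

  uv-separator-full-components : ∀ {S a b} → Decidable S → IsUVSeparator G S a b →
                                 FullComponents S a b
  uv-separator-full-components S? uv =
    uv-separator-full S? uv , uv-separator-full S? (uv-separator-sym uv) , proj₂ (proj₂ (proj₁ uv))

  -- A decidable stand-in for IsUVSeparator: minimal only against single-vertex deletions.
  -- For decidable S the two notions agree.
  Irredundant : VSet n → Fin n → Fin n → Set
  Irredundant S a b = Separates G S a b × (∀ z → S z → ¬ Separates G (S ∖ ｛ z ｝) a b)

  IsIrredundant : VSet n → Set
  IsIrredundant S = ∃ λ a → ∃ λ b → Irredundant S a b

  irredundant? : ∀ {S} → Decidable S → ∀ a b → Dec (Irredundant S a b)
  irredundant? S? a b =
    separates? S? a b ×-dec all? (λ z → S? z →-dec ¬? (separates? (S? ∩? ∁? (z ≟F_)) a b))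

  isIrredundant? : ∀ {S} → Decidable S → Dec (IsIrredundant S)
  isIrredundant? S? = any? λ a → any? λ b → irredundant? S? a b

  irredundant⇒uv-separator : ∀ {S a b} → Decidable S → Irredundant S a b → IsUVSeparator G S a b
  irredundant⇒uv-separator {S} S? (sep , irr) = sep , minimal
    where
    minimal : ∀ T → _⊂_ G T S → ¬ Separates G T _ _
    minimal T (T⊆S , S⊈T) sepT = ¬¬-∀-Fin pointwise λ S⊆T → S⊈T (S⊆T _)
      where
      pointwise : ∀ z → ¬ ¬ (S z → T z)
      pointwise z ¬S⊆T with S? z
      ... | no z∉S  = ¬S⊆T (⊥-elim ∘ z∉S)
      ... | yes z∈S =
        irr z z∈S (separates-mono T⊆S∖z (proj₁ sep ∘ proj₁) (proj₁ (proj₂ sep) ∘ proj₁) sepT)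
        where
        T⊆S∖z : T ⊆ S ∖ ｛ z ｝
        T⊆S∖z t = T⊆S t , λ { refl → ¬S⊆T (λ _ → t) }

  uv-separator⇒irredundant : ∀ {S a b} → IsUVSeparator G S a b → Irredundant S a b
  uv-separator⇒irredundant (sep , minimal) =
    sep , λ z z∈S → minimal _ (proj₁ , λ S⊆S∖z → proj₂ (S⊆S∖z z∈S) refl)

  irredundant-resp-≐ : ∀ {S T} → Decidable S → S ≐ T → IsIrredundant S → IsIrredundant T
  irredundant-resp-≐ S? S≐T (a , b , irr) =
    a , b , uv-separator⇒irredundant (uv-separator-resp-≐ S≐T (irredundant⇒uv-separator S? irr))

  irredundant-below : ∀ {S x y} (S? : Decidable S) → Acc Sub._⊂_ (toSubset S?) →
                      Separates G S x y → ∃ λ T → Decidable T × Irredundant T x y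
  irredundant-below {S} {x} {y} S? (acc rec) sep
    with any? (λ z → S? z ×-dec separates? (S? ∩? ∁? (z ≟F_)) x y)
  ... | no ¬z = S , S? , sep , λ z z∈S sep′ → ¬z (z , z∈S , sep′)
  ... | yes (z , z∈S , sep′) =
    irredundant-below S∖z? (rec (toSubset-⊂ S∖z? S? proj₁ z∈S (λ z∈S∖z → proj₂ z∈S∖z refl))) sep′
    where
    S∖z? = S? ∩? ∁? (z ≟F_)

  minimal-separator-exists : ∀ {x y} → x ≢ y → ¬ Adj G x y →
                             ∃ λ T → Decidable T × IsUVSeparator G T x y
  minimal-separator-exists {x} {y} x≢y ¬xy
    with irredundant-below Others? (⊂-wellFounded _) (x∉ , y∉ , λ r → x≢y (stuck r))
    where
    Others : VSet n
    Others z = x ≢ z × y ≢ z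
    Others? : Decidable Others
    Others? z = ¬? (x ≟F z) ×-dec ¬? (y ≟F z)
    x∉ : x ∉ Others
    x∉ (x≢x , _) = x≢x refl
    y∉ : y ∉ Others
    y∉ (_ , y≢y) = y≢y refl
    stuck : ∀ {z} → Reach G Others x z → x ≡ z
    stuck (here _) = refl
    stuck {z} (step r a z∉) with stuck r | x ≟F z | y ≟F z
    ... | refl | yes x≡z | _        = x≡z
    ... | refl | no _    | yes refl = ⊥-elim (¬xy a)
    ... | refl | no x≢z  | no y≢z   = ⊥-elim (z∉ (x≢z , y≢z))
  ... | T , T? , irr = T , T? , irredundant⇒uv-separator T? irr

  MaximalIrredundant : VSet n → Set₁
  MaximalIrredundant S =
    IsIrredundant S × (∀ T → Decidable T → IsIrredundant T → S ⊆ T → T ⊆ S)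

  maximal-irredundant⇒maximal-separator : ∀ {S} → Decidable S → MaximalIrredundant S →
                                          IsMaximalSeparator G S
  maximal-irredundant⇒maximal-separator S? ((a , b , irr) , maximal) =
    (a , b , irredundant⇒uv-separator S? irr) ,
    λ T (c , d , uv) S⊆T {x} x∈T → decidable-stable (S? x) λ x∉S →
      ¬¬-decidable T λ T? → x∉S (maximal T T? (c , d , uv-separator⇒irredundant uv) S⊆T x∈T)

  maximal-irredundant-above : ∀ {S} (S? : Decidable S) → Acc Sub._⊃_ (toSubset S?) → IsIrredundant S →
                              ∃ λ S* → Decidable S* × MaximalIrredundant S* × S ⊆ S*
  maximal-irredundant-above S? (acc rec) irr
    with anySubset? (λ p → isIrredundant? (_∈ₛ? p) ×-dec all? (λ x → S? x →-dec (x ∈ₛ? p))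
                                             ×-dec any? (λ x → (x ∈ₛ? p) ×-dec ¬? (S? x)))
  ... | yes (p , irrₚ , S⊆p , x , x∈p , x∉S)
    with maximal-irredundant-above (_∈ₛ? p) (rec (toSubset-⊂ S? (_∈ₛ? p) (S⊆p _) x∈p x∉S)) irrₚ
  ...   | S* , S*? , max , p⊆S* = S* , S*? , max , p⊆S* ∘ S⊆p _
  maximal-irredundant-above {S} S? (acc rec) irr | no ¬larger = S , S? , (irr , maximal) , id
    where
    maximal : ∀ T → Decidable T → IsIrredundant T → S ⊆ T → T ⊆ S
    maximal T T? irrT S⊆T {x} x∈T = decidable-stable (S? x) λ x∉S →
      ¬larger (toSubset T? , irredundant-resp-≐ T? (toSubset-≐ T?) irrT ,
               (λ _ → ∈-toSubset⁺ T? ∘ S⊆T) , x , ∈-toSubset⁺ T? x∈T , x∉S)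

  maximal-separator-above : ∀ {T} → Decidable T → IsSeparator G T →
                            ∃ λ S → Decidable S × IsMaximalSeparator G S × T ⊆ S
  maximal-separator-above T? (a , b , uv)
    with maximal-irredundant-above T? (⊃-wellFounded _) (a , b , uv-separator⇒irredundant uv)
  ... | S , S? , max , T⊆S = S , S? , maximal-irredundant⇒maximal-separator S? max , T⊆S

  -- Walks and induced cycles

  switch : ℕ → (ℕ → Fin n) → (ℕ → Fin n) → ℕ → Fin n
  switch k P Q i with i ℕ.≤? k
  ... | yes _ = P i
  ... | no _  = Q i

  switch-≤ : ∀ {k i} P Q → i ≤ k → switch k P Q i ≡ P i
  switch-≤ {k} {i} _ _ i≤k with i ℕ.≤? k
  ... | yes _   = refl
  ... | no  i≰k = ⊥-elim (i≰k i≤k)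

  switch-> : ∀ {k i} P Q → k < i → switch k P Q i ≡ Q i
  switch-> {k} {i} _ _ k<i with i ℕ.≤? k
  ... | yes i≤k = ⊥-elim (<⇒≱ k<i i≤k)
  ... | no  _   = refl

  -- Only P 0, …, P k matter; P is arbitrary beyond k.
  record Walk (A : VSet n) (s t : Fin n) (k : ℕ) (P : ℕ → Fin n) : Set where
    field
      start    : P 0 ≡ s
      end      : P k ≡ t
      adjacent : ∀ i → i < k → Adj G (P i) (P (suc i))
      inner    : ∀ i → 0 < i → i < k → A (P i)
  open Walk

  HasWalk : VSet n → Fin n → Fin n → ℕ → Set
  HasWalk A s t k = ∃ (Walk A s t k)

  Shortest : VSet n → Fin n → Fin n → ℕ → Set
  Shortest A s t k = ∀ j → j < k → ¬ HasWalk A s t j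

  shortest-exists : ∀ {A s t k} → HasWalk A s t k → ¬ ¬ ∃ λ k → HasWalk A s t k × Shortest A s t k
  shortest-exists {A} {s} {t} {k} w found =
    <-rec (¬_ ∘ HasWalk A s t) (λ k shorter w → found (k , w , λ j j<k → shorter j<k)) k w

  snoc : ℕ → (ℕ → Fin n) → Fin n → ℕ → Fin n
  snoc k P v = switch k P (λ _ → v)

  edge-walk : ∀ {A s t} → Adj G s t → Walk A s t 1 (snoc 0 (λ _ → s) t)
  edge-walk s~t = record
    { start    = refl
    ; end      = refl
    ; adjacent = λ { 0 _ → s~t ; (suc _) (s≤s ()) }
    ; inner    = λ { (suc _) _ (s≤s ()) } }

  walk-snoc : ∀ {A s x y k P} → Walk A s x k P → A x → Adj G x y → Walk A s y (suc k) (snoc k P y)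
  walk-snoc {A} {y = y} {k} {P} w x∈A x~y = record
    { start    = start w
    ; end      = switch-> P _ (n<1+n k)
    ; adjacent = adjacent′
    ; inner    = inner′ }
    where
    Y = λ (_ : ℕ) → y
    adjacent′ : ∀ i → i < suc k → Adj G (snoc k P y i) (snoc k P y (suc i))
    adjacent′ i i<1+k with m≤n⇒m<n∨m≡n (s≤s⁻¹ i<1+k)
    ... | inj₁ i<k  = subst₂ (Adj G) (sym (switch-≤ P Y (<⇒≤ i<k))) (sym (switch-≤ P Y i<k))
                        (adjacent w i i<k)
    ... | inj₂ refl = subst₂ (Adj G) (sym (trans (switch-≤ P Y ≤-refl) (end w)))
                        (sym (switch-> P Y (n<1+n k))) x~y
    inner′ : ∀ i → 0 < i → i < suc k → A (snoc k P y i)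
    inner′ i 0<i i<1+k with m≤n⇒m<n∨m≡n (s≤s⁻¹ i<1+k)
    ... | inj₁ i<k  = subst A (sym (switch-≤ P Y (<⇒≤ i<k))) (inner w i 0<i i<k)
    ... | inj₂ refl = subst A (sym (trans (switch-≤ P Y ≤-refl) (end w))) x∈A

  walk-along : ∀ {A B s c x} → Adj G s c → Reach G B c ⊆ A → Reach G B c x →
               ∃ λ k → HasWalk A s x k
  walk-along s~c inA (here _) = 1 , _ , edge-walk s~c
  walk-along s~c inA (step r w~y _) with walk-along s~c inA r
  ... | k , _ , w = suc k , _ , walk-snoc w (inA r) w~y

  walk-through-full : ∀ {S a s t} → Full S a → S s → S t → ∃ λ k → HasWalk (Reach G S a) s t k
  walk-through-full full s∈S t∈S with full s∈S | full t∈S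
  ... | c , a⇝c , c~s | d , a⇝d , d~t
    with walk-along (Adj-sym G c~s) (reach-trans a⇝c) (reach-trans (reach-sym a⇝c) a⇝d)
  ...   | k , _ , w = suc k , _ , walk-snoc w a⇝d d~t

  walk-length-≥2 : ∀ {A s t k P} → Walk A s t k P → s ≢ t → ¬ Adj G s t → 2 ≤ k
  walk-length-≥2 {k = 0}           w s≢t _    = ⊥-elim (s≢t (trans (sym (start w)) (end w)))
  walk-length-≥2 {k = 1}           w _   ¬s~t =
    ⊥-elim (¬s~t (subst₂ (Adj G) (start w) (end w) (adjacent w 0 (s≤s z≤n))))
  walk-length-≥2 {k = suc (suc k)} _ _   _    = s≤s (s≤s z≤n)

  shortcut : ℕ → ℕ → (ℕ → Fin n) → ℕ → Fin n
  shortcut i d P = switch i P (P ∘ (_+ d))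

  shortcut-walk : ∀ {A s t P} k d → Walk A s t (k + d) P → ∀ i → i ≤ k →
                  (i < k → Adj G (P i) (P (suc i + d))) → (i ≡ k → P i ≡ t) →
                  Walk A s t k (shortcut i d P)
  shortcut-walk {A} {P = P} k d w i i≤k jump at-end = record
    { start    = start w
    ; end      = end-shortcut
    ; adjacent = adjacent′
    ; inner    = inner′ }
    where
    P+d = P ∘ (_+ d)
    end-shortcut : shortcut i d P k ≡ _
    end-shortcut with m≤n⇒m<n∨m≡n i≤k
    ... | inj₁ i<k  = trans (switch-> P P+d i<k) (end w)
    ... | inj₂ refl = trans (switch-≤ P P+d ≤-refl) (at-end refl)
    adjacent′ : ∀ m → m < k → Adj G (shortcut i d P m) (shortcut i d P (suc m))
    adjacent′ m m<k with <-cmp m i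
    ... | tri< m<i _ _ = subst₂ (Adj G) (sym (switch-≤ P P+d (<⇒≤ m<i))) (sym (switch-≤ P P+d m<i))
                           (adjacent w m (<-≤-trans m<k (m≤m+n k d)))
    ... | tri≈ _ refl _ = subst₂ (Adj G) (sym (switch-≤ P P+d ≤-refl)) (sym (switch-> P P+d (n<1+n i)))
                           (jump m<k)
    ... | tri> _ _ i<m = subst₂ (Adj G) (sym (switch-> P P+d i<m)) (sym (switch-> P P+d (m<n⇒m<1+n i<m)))
                           (adjacent w (m + d) (+-monoˡ-< d m<k))
    inner′ : ∀ m → 0 < m → m < k → A (shortcut i d P m)
    inner′ m 0<m m<k with ≤-<-connex m i
    ... | inj₁ m≤i = subst A (sym (switch-≤ P P+d m≤i)) (inner w m 0<m (<-≤-trans m<k (m≤m+n k d)))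
    ... | inj₂ i<m = subst A (sym (switch-> P P+d i<m))
                       (inner w (m + d) (<-≤-trans 0<m (m≤m+n m d)) (+-monoˡ-< d m<k))

  no-shortcut : ∀ {A s t K P} → Walk A s t K P → Shortest A s t K → ∀ i d → 0 < d → i + d ≤ K →
                (i + d < K → Adj G (P i) (P (suc (i + d)))) → (i + d ≡ K → P i ≡ t) → ⊥
  no-shortcut {A} {s} {t} {K} {P} w shortest i d 0<d i+d≤K =
    go (K ∸ d) (m∸n+n≡m (≤-trans (m≤n+m d i) i+d≤K)) w shortest i+d≤K
    where
    go : ∀ {K} k → k + d ≡ K → Walk A s t K P → Shortest A s t K → i + d ≤ K →
         (i + d < K → Adj G (P i) (P (suc (i + d)))) → (i + d ≡ K → P i ≡ t) → ⊥
    go k refl w shortest i+d≤K jump at-end =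
      shortest k (m<m+n k 0<d)
        (_ , shortcut-walk k d w i (+-cancelʳ-≤ d i k i+d≤K) (jump ∘ +-monoˡ-< d) (at-end ∘ cong (_+ d)))

  shortest-injective : ∀ {A s t K P} → Walk A s t K P → Shortest A s t K →
                       ∀ {i j} → i < j → j ≤ K → P i ≢ P j
  shortest-injective {K = K} {P} w shortest {i} {j} i<j j≤K Pi≡Pj =
    no-shortcut w shortest i (j ∸ i) (m<n⇒0<n∸m i<j) (subst (_≤ K) (sym i+d≡j) j≤K) jump at-end
    where
    i+d≡j : i + (j ∸ i) ≡ j
    i+d≡j = m+[n∸m]≡n (<⇒≤ i<j)
    jump : i + (j ∸ i) < K → Adj G (P i) (P (suc (i + (j ∸ i))))
    jump lt = subst₂ (Adj G) (sym Pi≡Pj) (cong (P ∘ suc) (sym i+d≡j))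
                (adjacent w j (subst (_< K) i+d≡j lt))
    at-end : i + (j ∸ i) ≡ K → P i ≡ _
    at-end e = trans Pi≡Pj (trans (cong P (trans (sym i+d≡j) e)) (end w))

  shortest-chordless : ∀ {A s t K P} → Walk A s t K P → Shortest A s t K →
                       ∀ {i j} → i < j → j ≤ K → Adj G (P i) (P j) → j ≡ suc i
  shortest-chordless {K = K} {P} w shortest {i} {j} i<j j≤K i~j with j ℕ.≟ suc i
  ... | yes j≡1+i = j≡1+i
  ... | no  j≢1+i = ⊥-elim (no-shortcut w shortest i d (m<n⇒0<n∸m 1+i<j) (<⇒≤ i+d<K) jump at-end)
    where
    1+i<j : suc i < j
    1+i<j = ≤∧≢⇒< i<j (j≢1+i ∘ sym)
    d = j ∸ suc i
    1+i+d≡j : suc (i + d) ≡ j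
    1+i+d≡j = m+[n∸m]≡n (<⇒≤ 1+i<j)
    i+d<K : i + d < K
    i+d<K = <-≤-trans (subst (i + d <_) 1+i+d≡j (n<1+n (i + d))) j≤K
    jump : i + d < K → Adj G (P i) (P (suc (i + d)))
    jump _ = subst (Adj G (P i) ∘ P) (sym 1+i+d≡j) i~j
    at-end : i + d ≡ K → P i ≡ _
    at-end e = ⊥-elim (<⇒≢ i+d<K e)

  record IsInducedCycleℕ (L : ℕ) (g : ℕ → Fin n) : Set where
    field
      injective    : ∀ {i j} → i < j → j < L → g i ≢ g j
      path-edge    : ∀ {i} → suc i < L → Adj G (g i) (g (suc i))
      closing-edge : ∀ {j} → suc j ≡ L → Adj G (g 0) (g j)
      no-chord     : ∀ {i j} → i < j → j < L → Adj G (g i) (g j) →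
                     j ≡ suc i ⊎ (i ≡ 0 × suc j ≡ L)

  CyclicSucc : ℕ → ℕ → ℕ → Set
  CyclicSucc L x y = y ≡ suc x ⊎ (suc x ≡ L × y ≡ 0)

  module _ (m : ℕ) where

    %⇒cyclicSucc : ∀ {x y} → x < 4 + m → suc x % (4 + m) ≡ y → CyclicSucc (4 + m) x y
    %⇒cyclicSucc x<L e with m≤n⇒m<n∨m≡n x<L
    ... | inj₁ 1+x<L = inj₁ (trans (sym e) (m<n⇒m%n≡m 1+x<L))
    ... | inj₂ 1+x≡L = inj₂ (1+x≡L , trans (sym e) (trans (cong (_% (4 + m)) 1+x≡L) (n%n≡0 (4 + m))))

    cyclicSucc⇒% : ∀ {x y} → y < 4 + m → CyclicSucc (4 + m) x y → suc x % (4 + m) ≡ y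
    cyclicSucc⇒% y<L (inj₁ refl)         = m<n⇒m%n≡m y<L
    cyclicSucc⇒% _   (inj₂ (1+x≡L , refl)) = trans (cong (_% (4 + m)) 1+x≡L) (n%n≡0 (4 + m))

    induced-cycle-Fin : ∀ {g} → IsInducedCycleℕ (4 + m) g → IsInducedCycle G m (g ∘ toℕ)
    induced-cycle-Fin {g} cyc = injective′ , λ i j → mk⇔ (to i j) (from i j)
      where
      open IsInducedCycleℕ cyc
      L = 4 + m
      injective′ : ∀ {x y : Fin L} → g (toℕ x) ≡ g (toℕ y) → x ≡ y
      injective′ {x} {y} e with <-cmp (toℕ x) (toℕ y)
      ... | tri< x<y _ _ = ⊥-elim (injective x<y (toℕ<n y) e)
      ... | tri≈ _ x≡y _ = toℕ-injective x≡y
      ... | tri> _ _ y<x = ⊥-elim (injective y<x (toℕ<n x) (sym e))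
      edge⇒succ : ∀ {x y} → x < L → y < L → Adj G (g x) (g y) → CyclicSucc L x y ⊎ CyclicSucc L y x
      edge⇒succ {x} {y} x<L y<L a with <-cmp x y
      ... | tri≈ _ refl _ = ⊥-elim (irrefl G a)
      ... | tri< x<y _ _ = [ inj₁ ∘ inj₁ , (λ (x≡0 , 1+y≡L) → inj₂ (inj₂ (1+y≡L , x≡0))) ]
                             (no-chord x<y y<L a)
      ... | tri> _ _ y<x = [ inj₂ ∘ inj₁ , (λ (y≡0 , 1+x≡L) → inj₁ (inj₂ (1+x≡L , y≡0))) ]
                             (no-chord y<x x<L (Adj-sym G a))
      succ⇒edge : ∀ {x y} → y < L → CyclicSucc L x y → Adj G (g x) (g y)
      succ⇒edge y<L (inj₁ refl)          = path-edge y<L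
      succ⇒edge _   (inj₂ (1+x≡L , refl)) = Adj-sym G (closing-edge 1+x≡L)
      to : ∀ i j → Adj G (g (toℕ i)) (g (toℕ j)) → CycAdj G m i j
      to i j a = Data.Sum.map (cyclicSucc⇒% (toℕ<n j)) (cyclicSucc⇒% (toℕ<n i))
                   (edge⇒succ (toℕ<n i) (toℕ<n j) a)
      from : ∀ i j → CycAdj G m i j → Adj G (g (toℕ i)) (g (toℕ j))
      from i j (inj₁ e) = succ⇒edge (toℕ<n j) (%⇒cyclicSucc (toℕ<n i) e)
      from i j (inj₂ e) = Adj-sym G (succ⇒edge (toℕ<n i) (%⇒cyclicSucc (toℕ<n j) e))

  chordal-no-long-cycle : Chordal G → ∀ {L g} → 4 ≤ L → ¬ IsInducedCycleℕ L g
  chordal-no-long-cycle chordal {L} 4≤L cyc =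
    chordal (L ∸ 4) _
      (induced-cycle-Fin (L ∸ 4) (subst (λ L → IsInducedCycleℕ L _) (sym (m+[n∸m]≡n 4≤L)) cyc))

  data Side (k : ℕ) : ℕ → Set where
    first  : ∀ {i} → i < k → Side k i
    joint  : Side k k
    second : ∀ {j} → 0 < j → Side k (k + j)

  side : ∀ k i → Side k i
  side k i with <-cmp i k
  ... | tri< i<k _ _ = first i<k
  ... | tri≈ _ refl _ = joint
  ... | tri> _ _ k<i = subst (Side k) (m+[n∸m]≡n (<⇒≤ k<i)) (second (m<n⇒0<n∸m k<i))

  append : ℕ → (ℕ → Fin n) → (ℕ → Fin n) → ℕ → Fin n
  append k P Q = switch k P (Q ∘ (_∸ k))

  module GluedWalks {A B s t k l P Q}
    (wP : Walk A s t k P) (shortP : Shortest A s t k)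
    (wQ : Walk B t s l Q) (shortQ : Shortest B t s l)
    (apart : ∀ {x y} → A x → B y → ¬ Adj G x y × x ≢ y)
    (2≤l : 2 ≤ l) where

    g = append k P Q

    g-first : ∀ {i} → i ≤ k → g i ≡ P i
    g-first = switch-≤ P _

    g-second : ∀ {j} → 0 < j → g (k + j) ≡ Q j
    g-second {j} 0<j = trans (switch-> P _ (m<m+n k 0<j)) (cong Q (m+n∸m≡n k j))

    g-joint : g k ≡ Q 0
    g-joint = trans (g-first ≤-refl) (trans (end wP) (sym (start wQ)))

    g-zero : g 0 ≡ Q l
    g-zero = trans (g-first z≤n) (trans (start wP) (sym (end wQ)))

    0<l : 0 < l
    0<l = <-≤-trans (s≤s z≤n) 2≤l

    injective : ∀ {i j} → i < j → j < k + l → g i ≢ g j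
    injective {i} {j} i<j j<L e with side k j
    ... | first j<k = shortest-injective wP shortP i<j (<⇒≤ j<k)
                        (trans (sym (g-first (<⇒≤ (<-trans i<j j<k)))) (trans e (g-first (<⇒≤ j<k))))
    ... | joint     = shortest-injective wP shortP i<j ≤-refl
                        (trans (sym (g-first (<⇒≤ i<j))) (trans e (g-first ≤-refl)))
    ... | second {jj} 0<jj with side k i | +-cancelˡ-< k jj l j<L
    ...   | second {ii} 0<ii  | jj<l = shortest-injective wQ shortQ (+-cancelˡ-< k ii jj i<j) (<⇒≤ jj<l)
                                         (trans (sym (g-second 0<ii)) (trans e (g-second 0<jj)))
    ...   | joint             | jj<l = shortest-injective wQ shortQ 0<jj (<⇒≤ jj<l)
                                         (trans (sym g-joint) (trans e (g-second 0<jj)))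
    ...   | first {zero} _    | jj<l = shortest-injective wQ shortQ jj<l ≤-refl
                                         (trans (sym (g-second 0<jj)) (trans (sym e) g-zero))
    ...   | first {suc i} i<k | jj<l =
            proj₂ (apart (inner wP (suc i) (s≤s z≤n) i<k) (inner wQ jj 0<jj jj<l))
              (trans (sym (g-first (<⇒≤ i<k))) (trans e (g-second 0<jj)))

    no-chord : ∀ {i j} → i < j → j < k + l → Adj G (g i) (g j) →
               j ≡ suc i ⊎ (i ≡ 0 × suc j ≡ k + l)
    no-chord {i} {j} i<j j<L i~j with side k j
    ... | first j<k = inj₁ (shortest-chordless wP shortP i<j (<⇒≤ j<k)
                        (subst₂ (Adj G) (g-first (<⇒≤ (<-trans i<j j<k))) (g-first (<⇒≤ j<k)) i~j))
    ... | joint     = inj₁ (shortest-chordless wP shortP i<j ≤-refl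
                        (subst₂ (Adj G) (g-first (<⇒≤ i<j)) (g-first ≤-refl) i~j))
    ... | second {jj} 0<jj with side k i | +-cancelˡ-< k jj l j<L
    ...   | second {ii} 0<ii  | jj<l =
            inj₁ (trans (cong (k +_) (shortest-chordless wQ shortQ (+-cancelˡ-< k ii jj i<j) (<⇒≤ jj<l)
                                        (subst₂ (Adj G) (g-second 0<ii) (g-second 0<jj) i~j)))
                        (+-suc k ii))
    ...   | joint             | jj<l =
            inj₁ (trans (cong (k +_) (shortest-chordless wQ shortQ 0<jj (<⇒≤ jj<l)
                                        (subst₂ (Adj G) g-joint (g-second 0<jj) i~j)))
                        (+-comm k 1))
    ...   | first {zero} _    | jj<l =
            inj₂ (refl , sym (trans (cong (k +_) (shortest-chordless wQ shortQ jj<l ≤-refl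
                                                    (Adj-sym G (subst₂ (Adj G) g-zero (g-second 0<jj) i~j))))
                                    (+-suc k jj)))
    ...   | first {suc i} i<k | jj<l =
            ⊥-elim (proj₁ (apart (inner wP (suc i) (s≤s z≤n) i<k) (inner wQ jj 0<jj jj<l))
                      (subst₂ (Adj G) (g-first (<⇒≤ i<k)) (g-second 0<jj) i~j))

    path-edge : ∀ {i} → suc i < k + l → Adj G (g i) (g (suc i))
    path-edge {i} 1+i<L with side k i
    ... | first i<k = subst₂ (Adj G) (sym (g-first (<⇒≤ i<k))) (sym (g-first i<k)) (adjacent wP i i<k)
    ... | joint     = subst₂ (Adj G) (sym g-joint) (trans (sym (g-second (s≤s z≤n))) (cong g (+-comm k 1)))
                        (adjacent wQ 0 0<l)
    ... | second {ii} 0<ii =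
          subst₂ (Adj G) (sym (g-second 0<ii)) (trans (sym (g-second (s≤s z≤n))) (cong g (+-suc k ii)))
            (adjacent wQ ii (+-cancelˡ-< k ii l (<-trans (n<1+n (k + ii)) 1+i<L)))

    closing-edge : ∀ {j} → suc j ≡ k + l → Adj G (g 0) (g j)
    closing-edge {j} e with side k j
    ... | first j<k = ⊥-elim (<⇒≢ (≤-<-trans j<k (m<m+n k 0<l)) e)
    ... | joint     = ⊥-elim (<⇒≢ (subst (_< k + l) (+-comm k 1) (+-monoʳ-< k 2≤l)) e)
    ... | second {jj} 0<jj = subst₂ (Adj G) (sym g-zero) (sym (g-second 0<jj))
                               (Adj-sym G (subst (Adj G (Q jj) ∘ Q) 1+jj≡l (adjacent wQ jj jj<l)))
      where
      1+jj≡l : suc jj ≡ l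
      1+jj≡l = +-cancelˡ-≡ k _ _ (trans (+-suc k jj) e)
      jj<l : jj < l
      jj<l = subst (jj <_) 1+jj≡l (n<1+n jj)

    isInducedCycle : IsInducedCycleℕ (k + l) g
    isInducedCycle = record
      { injective = injective ; path-edge = path-edge ; closing-edge = closing-edge ; no-chord = no-chord }

  -- Dirac: shortest paths through the two full components close up into an induced cycle.
  minimal-separator-clique : Chordal G → ∀ {S a b} → Decidable S → IsUVSeparator G S a b → IsClique G S
  minimal-separator-clique chordal S? uv {s} {t} s∈S t∈S s≢t
    with uv-separator-full-components S? uv
  ... | fullᵃ , fullᵇ , ¬ab = decidable-stable (adj? G s t) λ ¬s~t →
    shortest-exists (proj₂ (walk-through-full fullᵃ s∈S t∈S)) λ (k , (P , wP) , shortP) →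
    shortest-exists (proj₂ (walk-through-full fullᵇ t∈S s∈S)) λ (l , (Q , wQ) , shortQ) →
    let 2≤k = walk-length-≥2 wP s≢t ¬s~t
        2≤l = walk-length-≥2 wQ (s≢t ∘ sym) (¬s~t ∘ Adj-sym G)
    in chordal-no-long-cycle chordal (+-mono-≤ 2≤k 2≤l)
         (GluedWalks.isInducedCycle wP shortP wQ shortQ (reach-apart ¬ab) 2≤l)

  -- Special vertices

  clique-side-special : ∀ {S u u′} → Decidable S → IsMaximalSeparator G S → FullComponents S u u′ →
                        IsClique G (S ∪ Reach G S u) → IsSpecial G u
  clique-side-special {S} {u} S? max (fullᵤ , fullᵤ′ , ¬uu′) clique =
    (λ u~x u~y → clique (near u~x) (near u~y)) , maximal-separator-resp-≐ (S⊆Sᵤ , Sᵤ⊆S) max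
    where
    u∉S = full-∉ fullᵤ
    u∈ : (S ∪ Reach G S u) u
    u∈ = inj₂ (here u∉S)
    extend : ∀ {x y} → Reach G S u x → Adj G x y → (S ∪ Reach G S u) y
    extend {y = y} u⇝x x~y with S? y
    ... | yes y∈S = inj₁ y∈S
    ... | no  y∉S = inj₂ (step u⇝x x~y y∉S)
    near : ∀ {x} → Adj G u x → (S ∪ Reach G S u) x
    near = extend (here u∉S)
    S⊆Sᵤ : S ⊆ SV G u
    S⊆Sᵤ {x} x∈S with fullᵤ′ x∈S
    ... | c , u′⇝c , c~x = inj₂ (clique u∈ (inj₁ x∈S) (λ u≡x → u∉S (subst S (sym u≡x) x∈S))) ,
                           c , [ proj₂ apart ∘ sym , proj₁ apart ] , Adj-sym G c~x
      where apart = reach-apart ¬uu′ (here u∉S) u′⇝c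
    Sᵤ⊆S : SV G u ⊆ S
    Sᵤ⊆S {x} (x∈Q , y , y∉Q , x~y) = decidable-stable (S? x) λ x∉S → y∉Q (y∈Q x∉S)
      where
      y∈Q : x ∉ S → Q G u y
      y∈Q x∉S with y ≟F u
      ... | yes y≡u = inj₁ y≡u
      ... | no  y≢u = inj₂ (clique u∈ (extend u⇝x x~y) (y≢u ∘ sym))
        where
        u⇝x : Reach G S u x
        u⇝x = [ (λ x≡u → subst (Reach G S u) (sym x≡u) (here u∉S)) ,
                (λ u~x → step (here u∉S) u~x x∉S) ] x∈Q

  clique-or-nonadjacent-pair :
    Chordal G → ∀ {S a b u} → Decidable S → IsUVSeparator G S a b →
    IsClique G (S ∪ Reach G S u) ⊎
    ∃ λ x → ∃ λ y → Reach G S u x × (S ∪ Reach G S u) y × x ≢ y × ¬ Adj G x y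
  clique-or-nonadjacent-pair chordal {u = u} S? uv
    with any? (λ x → any? (λ y → closure? x ×-dec closure? y ×-dec ¬? (x ≟F y) ×-dec ¬? (adj? G x y)))
    where closure? = S? ∪? reach? S? u
  ... | no ¬pair = inj₁ λ {x} {y} x∈ y∈ x≢y →
          decidable-stable (adj? G x y) λ ¬x~y → ¬pair (x , y , x∈ , y∈ , x≢y , ¬x~y)
  ... | yes (x , y , inj₂ u⇝x , y∈ , x≢y , ¬x~y) = inj₂ (x , y , u⇝x , y∈ , x≢y , ¬x~y)
  ... | yes (x , y , inj₁ x∈S , inj₂ u⇝y , x≢y , ¬x~y) =
          inj₂ (y , x , u⇝y , inj₁ x∈S , x≢y ∘ sym , ¬x~y ∘ Adj-sym G)
  ... | yes (x , y , inj₁ x∈S , inj₁ y∈S , x≢y , ¬x~y) =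
          ⊥-elim (¬x~y (minimal-separator-clique chordal S? uv x∈S y∈S x≢y))

  separator-meets-component : ∀ {S T u x y} → Decidable S → Decidable T → Full S u → Reach G S u x →
                              (S ∪ Reach G S u) y → Separates G T x y → ∃ λ t → T t × Reach G S u t
  separator-meets-component {S} {T} {u} {x} {y} S? T? fullᵤ u⇝x y∈ (_ , y∉T , ¬xy)
    with any? (λ t → T? t ×-dec reach? S? u t)
  ... | yes meet = meet
  ... | no ¬meet = ⊥-elim (¬xy (path y∈))
    where
    avoid : ∀ {z} → Reach G S x z → Reach G T x z
    avoid x⇝z = reach-restrict x⇝z λ x⇝z′ z′∈T → ¬meet (_ , z′∈T , reach-trans u⇝x x⇝z′)
    path : (S ∪ Reach G S u) y → Reach G T x y
    path (inj₂ u⇝y) = avoid (reach-trans (reach-sym u⇝x) u⇝y)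
    path (inj₁ y∈S) with fullᵤ y∈S
    ... | c , u⇝c , c~y = step (avoid (reach-trans (reach-sym u⇝x) u⇝c)) c~y y∉T

  component-avoids-clique : ∀ {S T w s} → IsClique G S → S s → ¬ T s → ¬ Reach G T w s →
                            ∀ {x} → Reach G T w x → x ∉ S
  component-avoids-clique {s = s} clique s∈S s∉T ¬ws {x} w⇝x x∈S with x ≟F s
  ... | yes refl = ¬ws w⇝x
  ... | no  x≢s  = ¬ws (step w⇝x (clique x∈S s∈S x≢s) s∉T)

  component-inside : ∀ {S T u w t c} → (∀ {x} → Reach G T w x → x ∉ S) → Reach G S u t →
                     Reach G T w c → Adj G c t → Reach G T w ⊆ Reach G S u
  component-inside avoid u⇝t w⇝c c~t w⇝x =
    reach-trans (step u⇝t (Adj-sym G c~t) (avoid w⇝c))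
      (reach-trans (reach-sym (reach-restrict w⇝c avoid)) (reach-restrict w⇝x avoid))

  full-components-avoiding : ∀ {T a b} → Decidable T → FullComponents T a b → ∀ s →
                             ∃ λ w → ∃ λ w′ → FullComponents T w w′ × ¬ Reach G T w s
  full-components-avoiding {a = a} T? fc s with reach? T? a s
  ... | no ¬as = _ , _ , fc , ¬as
  ... | yes as = _ , _ , full-components-sym fc , λ bs → proj₂ (proj₂ fc) (reach-trans as (reach-sym bs))

  -- Maximality of S gives some s ∈ S ∖ T, and the full component of T missing s misses the clique S.
  full-components-inside :
    Chordal G → ∀ {S T u t} → Decidable S → IsMaximalSeparator G S → Decidable T → IsSeparator G T →
    T t → Reach G S u t → ∃ λ w → ∃ λ w′ → FullComponents T w w′ × Reach G T w ⊆ Reach G S u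
  full-components-inside chordal {S} {T} S? ((_ , _ , uvS) , maximal) T? sepT@(_ , _ , uvT) t∈T u⇝t
    with any? (λ s → S? s ×-dec ¬? (T? s))
  ... | no ¬s = ⊥-elim (reach-∉ʳ u⇝t (maximal T sepT S⊆T t∈T))
    where
    S⊆T : S ⊆ T
    S⊆T {x} x∈S = decidable-stable (T? x) λ x∉T → ¬s (x , x∈S , x∉T)
  ... | yes (s , s∈S , s∉T)
    with full-components-avoiding T? (uv-separator-full-components T? uvT) s
  ...   | w , w′ , fc@(fullʷ , _) , ¬ws with fullʷ t∈T
  ...     | c , w⇝c , c~t = w , w′ , fc ,
            component-inside (component-avoids-clique (minimal-separator-clique chordal S? uvS) s∈S s∉T ¬ws)
              u⇝t w⇝c c~t

  special-in-component : Chordal G → ∀ {S u u′} → Decidable S → IsMaximalSeparator G S →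
                         FullComponents S u u′ → ∃ λ v → IsSpecial G v × Reach G S u v
  special-in-component chordal S? max fc = go S? max fc (⊂-wellFounded _)
    where
    go : ∀ {S u u′} (S? : Decidable S) → IsMaximalSeparator G S → FullComponents S u u′ →
         Acc Sub._⊂_ (toSubset (reach? S? u)) → ∃ λ v → IsSpecial G v × Reach G S u v
    go {u = u} S? max@((_ , _ , uvS) , _) fc@(fullᵤ , _) (acc rec)
      with clique-or-nonadjacent-pair chordal S? uvS
    ... | inj₁ clique = u , clique-side-special S? max fc clique , here (full-∉ fullᵤ)
    ... | inj₂ (x , y , u⇝x , y∈ , x≢y , ¬x~y) =
      let T , T? , uvT = minimal-separator-exists x≢y ¬x~y
          t , t∈T , u⇝t = separator-meets-component S? T? fullᵤ u⇝x y∈ (proj₁ uvT)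
          T* , T*? , maxT* , T⊆T* = maximal-separator-above T? (x , y , uvT)
          w , _ , fcʷ , inside = full-components-inside chordal S? max T*? (proj₁ maxT*) (T⊆T* t∈T) u⇝t
          smaller = toSubset-⊂ (reach? T*? w) (reach? S? u) inside u⇝t
                      (λ w⇝t → reach-∉ʳ w⇝t (T⊆T* t∈T))
          v , special , w⇝v = go T*? maxT* fcʷ (rec smaller)
      in v , special , inside w⇝v

nonadjacent-pair : ∀ {n} (G : Graph n) → ¬ IsCompleteGraph G →
                   ∃ λ x → ∃ λ y → x ≢ y × ¬ Adj G x y
nonadjacent-pair G incomplete with any? (λ x → any? (λ y → ¬? (x ≟F y) ×-dec ¬? (adj? G x y)))
... | yes pair = pair
... | no ¬pair = ⊥-elim (incomplete λ x y x≢y →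
                   decidable-stable (adj? G x y) λ ¬x~y → ¬pair (x , y , x≢y , ¬x~y))

maximal-separator-exists : ∀ {n} (G : Graph n) → ¬ IsCompleteGraph G →
                           ∃ λ S → Decidable S × IsMaximalSeparator G S
maximal-separator-exists G incomplete =
  let x , y , x≢y , ¬x~y = nonadjacent-pair G incomplete
      T , T? , uvT = minimal-separator-exists G x≢y ¬x~y
      S , S? , max , _ = maximal-separator-above G T? (x , y , uvT)
  in S , S? , max

theorem2 : ∀ (n : ℕ) (G : Graph n) → Chordal G → ¬ IsCompleteGraph G →
    ∃ λ u → ∃ λ v → IsSpecial G u × IsSpecial G v × ¬ Adj G u v × u ≢ v
theorem2 n G chordal incomplete =
  let S , S? , max = maximal-separator-exists G incomplete
      _ , _ , uvS = proj₁ max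
      full-components = uv-separator-full-components G S? uvS
      u , special-u , a⇝u = special-in-component G chordal S? max full-components
      v , special-v , b⇝v = special-in-component G chordal S? max (full-components-sym G full-components)
  in u , v , special-u , special-v , reach-apart G (proj₂ (proj₂ full-components)) a⇝u b⇝v
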